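{- Let $p$ be an odd prime, let $m\geq 3$ and $l$ be positive integers with $\gcd(m,l)=1$, $q=p^m$, and $\mathrm{Tr}$ the trace from $\mathbb{F}_q$ onto $\mathbb{F}_p$. Let $\mathcal{D}$ be either of the codes $$\mathcal{D}_1=\{(\mathrm{Tr}(ax^{p^l+1}+bx^2+cx)+h)_{x\in\mathbb{F}_q}: a,b,c\in\mathbb{F}_q, h\in\mathbb{F}_p\},\quad \mathcal{D}_2=\{(\mathrm{Tr}(ax^{p^l+1}+bx)+h)_{x\in\mathbb{F}_q}: a,b\in\mathbb{F}_q, h\in\mathbb{F}_p\},$$ with coordinates indexed by $\mathbb{F}_q$. Then for every $i>0$ such that $\mathcal{D}$ has a codeword of weight $i$ (i.e. $A_i\neq 0$), the supports of the codewords of weight $i$ in $\mathcal{D}$ form a $2$-design with point set $\mathbb{F}_q$.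
   Context: The support of a codeword $(c_x)_{x\in\mathbb{F}_q}$ is $\{x: c_x\neq 0\}$; $A_i$ is the number of codewords of Hamming weight $i$. A $t$-$(v,k,\lambda)$ design is a pair $(\mathcal{P},\mathcal{B})$ with $|\mathcal{P}|=v$, $\mathcal{B}$ a set of $k$-subsets (blocks) of $\mathcal{P}$, such that every $t$-subset of $\mathcal{P}$ is contained in exactly $\lambda$ blocks. In the paper $\mathcal{D}_1,\mathcal{D}_2$ are denoted $\overline{\mathcal{C}_1^{\perp}}^{\perp}$ and $\overline{\mathcal{C}_2^{\perp}}^{\perp}$. -}

module Defs where

open import Level using (0ℓ)
open import Data.Nat as ℕ using (ℕ; zero; suc)
open import Data.Fin using (Fin; toℕ)
open import Data.Fin.Subset using (Subset; _∈_; ∣_∣)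
open import Data.Vec using (tabulate)
open import Data.Bool using (Bool; true; false; not)
open import Data.List using (List; length)
open import Data.List.Relation.Unary.Unique.Propositional using (Unique)
import Data.List.Membership.Propositional as LM
open import Data.Product using (Σ; ∃; _×_; _,_)
open import Relation.Binary.PropositionalEquality using (_≡_; _≢_)
open import Relation.Nullary using (¬_)
open import Relation.Nullary.Decidable using (⌊_⌋)
open import Relation.Binary.Definitions using (DecidableEquality)
open import Algebra.Structures using (IsCommutativeRing)
open import Function.Bundles using (_↔_; Inverse)

record FiniteField (q : ℕ) : Set₁ where
  infixl 6 _+_
  infixl 7 _*_
  field
    Carrier : Set
    _+_ _*_ : Carrier → Carrier → Carrier
    -_      : Carrier → Carrier
    0# 1#   : Carrier
    isCommutativeRing : IsCommutativeRing _≡_ _+_ _*_ -_ 0# 1#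
    0≢1     : 0# ≢ 1#
    inverse : ∀ x → x ≢ 0# → ∃ λ y → x * y ≡ 1#
    _≟_     : DecidableEquality Carrier
    enum    : Fin q ↔ Carrier

  elt : Fin q → Carrier
  elt = Inverse.to enum

  _^_ : Carrier → ℕ → Carrier
  x ^ zero  = 1#
  x ^ suc n = x * (x ^ n)

  ι : ℕ → Carrier
  ι zero    = 0#
  ι (suc n) = 1# + ι n

  Σ< : ℕ → (ℕ → Carrier) → Carrier
  Σ< zero    f = 0#
  Σ< (suc n) f = Σ< n f + f n

module Setting (p m : ℕ) (F : FiniteField (p ℕ.^ m)) where
  open FiniteField F

  q : ℕ
  q = p ℕ.^ m

  InFp : Carrier → Set
  InFp h = ∃ λ (k : Fin p) → h ≡ ι (toℕ k)

  Tr : Carrier → Carrier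
  Tr x = Σ< m (λ j → x ^ (p ℕ.^ j))

  -- codewords are vectors (c_x) indexed by x ∈ F_q, i.e. functions F_q → F_q
  Word : Set
  Word = Carrier → Carrier

  InD₁ : ℕ → Word → Set
  InD₁ l w = Σ Carrier λ a → Σ Carrier λ b → Σ Carrier λ c → Σ Carrier λ h →
    InFp h × (∀ x → w x ≡ Tr (a * x ^ (p ℕ.^ l ℕ.+ 1) + b * x ^ 2 + c * x) + h)

  InD₂ : ℕ → Word → Set
  InD₂ l w = Σ Carrier λ a → Σ Carrier λ b → Σ Carrier λ h →
    InFp h × (∀ x → w x ≡ Tr (a * x ^ (p ℕ.^ l ℕ.+ 1) + b * x) + h)

  supp : Word → Subset q
  supp w = tabulate λ j → not ⌊ w (elt j) ≟ 0# ⌋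

  wt : Word → ℕ
  wt w = ∣ supp w ∣

  IsBlock : (Word → Set) → ℕ → Subset q → Set
  IsBlock C i S = Σ Word λ w → C w × wt w ≡ i × supp w ≡ S

HasCount : {A : Set} → (A → Set) → ℕ → Set
HasCount {A} P n = Σ (List A) λ xs →
  Unique xs × (∀ a → (a LM.∈ xs → P a) × (P a → a LM.∈ xs)) × length xs ≡ n

Is2Design : (v k λ' : ℕ) → (Subset v → Set) → Set
Is2Design v k λ' B =
  (∀ S → B S → ∣ S ∣ ≡ k) ×
  (∀ (x y : Fin v) → x ≢ y → HasCount (λ S → B S × x ∈ S × y ∈ S) λ')

module Submission where

open import Defs
open import Data.Nat using (ℕ; _≤_; _<_)
open import Data.Nat.GCD using (gcd)
open import Data.Nat.Primality using (Prime)
open import Data.Product using (Σ; _×_)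
open import Data.Sum using (_⊎_)
open import Relation.Binary.PropositionalEquality using (_≡_; _≢_)

open import Level using (0ℓ)
import Data.Nat as ℕ
open import Data.Nat using (zero; suc; _∸_; _!; s≤s; z≤n; NonZero)
import Data.Nat.Properties as ℕP
open import Data.Nat.Combinatorics using (_C_; nCn≡1; nCk≡n!/k![n-k]!; k![n∸k]!∣n!)
open import Data.Nat.Coprimality using (coprime-Bézout; prime⇒coprime)
open import Data.Nat.Divisibility using (_∣_; divides; ∣1⇒≡1; ∣⇒≤; m∣m*n)
open import Data.Nat.DivMod using (m/n*n≡m)
open import Data.Nat.GCD using (module Bézout)
open import Data.Nat.Primality using (euclidsLemma; ¬prime[1]; prime⇒nonZero; prime⇒nonTrivial)
open import Data.Bool using (Bool; true; false; not; if_then_else_)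
import Data.Bool as Bool
open import Data.Fin using (Fin; zero; suc; toℕ; punchIn; fromℕ; inject₁)
import Data.Fin.Properties as FinP
open import Data.Fin.Permutation using (permutation)
open import Data.Fin.Subset using (Subset; _∈_; ∣_∣)
open import Data.Fin.Subset.Properties using (_∈?_)
open import Data.Product using (∃; _,_; proj₁; proj₂)
open import Data.Sum using (inj₁; inj₂)
open import Data.Empty using (⊥-elim)
open import Data.Maybe using (Maybe; just; nothing)
open import Data.List using (List; length; map; filter; cartesianProductWith) renaming ([] to []ᴸ; _∷_ to _∷ᴸ_)
open import Data.List.Properties using (length-map)
import Data.List.Membership.Propositional as List
open import Data.List.Membership.Propositional.Properties
  using (∈-map⁻; ∈-map⁺; ∈-filter⁻; ∈-filter⁺; ∈-cartesianProductWith⁺)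
open import Data.List.Relation.Unary.Any using (here; there)
open import Data.List.Relation.Unary.All using () renaming ([] to []ᴬ; _∷_ to _∷ᴬ_)
open import Data.List.Relation.Unary.AllPairs using () renaming ([] to []ᴾ; _∷_ to _∷ᴾ_)
open import Data.List.Relation.Unary.Unique.Propositional using (Unique)
open import Data.List.Relation.Unary.Unique.Propositional.Properties
  using (map⁺; filter⁺; cartesianProductWith⁺)
open import Data.Vec using (Vec; []; _∷_; replicate; tabulate; lookup)
open import Data.Vec.Properties
  using (lookup∘tabulate; tabulate-cong; tabulate∘lookup; []=⇒lookup; lookup⇒[]=; ≡-dec)
open import Data.Vec.Functional using (tail) renaming (_∷_ to _∷ᶠ_)
open import Function using (_∘_; id; _↔_; Inverse; mk↔ₛ′)
open import Function.Definitions using (Injective)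
open import Function.Properties.Inverse using (↔-sym)
open import Relation.Nullary using (¬_; Dec; yes; no)
open import Relation.Nullary.Decidable using (⌊_⌋; map′; _×-dec_)
open import Relation.Unary using (Decidable)
open import Relation.Binary.Definitions using (tri<; tri≈; tri>)
open import Relation.Binary.PropositionalEquality
  using (refl; sym; trans; cong; cong₂; subst; module ≡-Reasoning)
open import Algebra.Bundles using (CommutativeRing; CommutativeMonoid)
open import Algebra.Structures using (IsCommutativeRing)
import Algebra.Properties.Ring as RingProperties
import Algebra.Properties.CommutativeMonoid.Sum as MonoidSum
import Algebra.Properties.CommutativeSemiring.Exp as Exp
import Algebra.Properties.CommutativeSemiring.Binomial as BinomialTheorem
import Algebra.Properties.Semiring.Mult as Mult
import Algebra.Solver.Ring.NaturalCoefficients as NaturalCoefficients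

-- The affine maps x ↦ u x + v (u ≠ 0) of F_q preserve both codes:
-- substituting u x + v into a x ^ (p ^ l + 1) + b x ^ 2 + c x gives a
-- polynomial of the same shape plus a constant, once the stray term in
-- x ^ (p ^ l) is moved onto x by Tr (y x ^ (p ^ l)) = Tr (y ^ (p ^ ((m − 1) l)) x);
-- the trace of the constant lies in F_p and is absorbed into h. These maps
-- permute the points, preserve weights, and act transitively on ordered
-- pairs of distinct points, so every pair lies in as many blocks of a given
-- size as {0, 1}.

module FieldProperties {q : ℕ} (F : FiniteField q) where
  open FiniteField F
  open IsCommutativeRing isCommutativeRing public
    using (+-comm; +-assoc; *-comm; *-assoc; distribˡ; +-identityˡ; +-identityʳ;
           *-identityˡ; *-identityʳ; zeroˡ; zeroʳ; -‿inverseˡ)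
  open ≡-Reasoning

  commutativeRing : CommutativeRing 0ℓ 0ℓ
  commutativeRing = record { isCommutativeRing = isCommutativeRing }

  open CommutativeRing commutativeRing
    using (ring; semiring; commutativeSemiring; +-commutativeMonoid; *-commutativeMonoid)
  open RingProperties ring public
    using (+-cancelˡ; +-identityʳ-unique; x∙y⁻¹≈ε⇒x≈y; -‿distribʳ-*; //-rightDividesˡ; //-rightDividesʳ)
  open Exp commutativeSemiring
    using () renaming (_^_ to _^ᴿ_; ^-homo-* to ^ᴿ-homo-*; ^-assocʳ to ^ᴿ-assocʳ; ^-distrib-* to ^ᴿ-distrib-*)
  open Mult semiring using (×-homo-+; ×1-homo-*; ×-assoc-*) renaming (_×_ to _·_)
  module Binomial = BinomialTheorem commutativeSemiring
  module +-Sum = MonoidSum +-commutativeMonoid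
  module *-Sum = MonoidSum *-commutativeMonoid

  decide-·1 : ∀ m n → Maybe (m · 1# ≡ n · 1#)
  decide-·1 m n with m ℕ.≟ n
  ... | yes refl = just refl
  ... | no _     = nothing

  open NaturalCoefficients commutativeSemiring decide-·1 public using (solve; _:+_; _:*_; _:=_)

  recip : ∀ {u} → u ≢ 0# → Carrier
  recip {u} u≢0 = proj₁ (inverse u u≢0)

  recip-inverseʳ : ∀ {u} (u≢0 : u ≢ 0#) → u * recip u≢0 ≡ 1#
  recip-inverseʳ {u} u≢0 = proj₂ (inverse u u≢0)

  recip-inverseˡ : ∀ {u} (u≢0 : u ≢ 0#) → recip u≢0 * u ≡ 1#
  recip-inverseˡ {u} u≢0 = trans (*-comm (recip u≢0) u) (recip-inverseʳ u≢0)

  *-cancel-inverse : ∀ {a b} → a * b ≡ 1# → ∀ x → a * (b * x) ≡ x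
  *-cancel-inverse {a} {b} ab≡1 x = trans (sym (*-assoc a b x)) (trans (cong (_* x) ab≡1) (*-identityˡ x))

  recip-nonzero : ∀ {u} (u≢0 : u ≢ 0#) → recip u≢0 ≢ 0#
  recip-nonzero {u} u≢0 u⁻¹≡0 = 0≢1 (begin
    0#              ≡⟨ sym (zeroʳ u) ⟩
    u * 0#          ≡⟨ cong (u *_) (sym u⁻¹≡0) ⟩
    u * recip u≢0   ≡⟨ recip-inverseʳ u≢0 ⟩
    1#              ∎)

  *-cancelˡ-nonzero : ∀ {x y} z → z ≢ 0# → z * x ≡ z * y → x ≡ y
  *-cancelˡ-nonzero {x} {y} z z≢0 zx≡zy = begin
    x                    ≡⟨ sym (*-cancel-inverse (recip-inverseˡ z≢0) x) ⟩
    recip z≢0 * (z * x)  ≡⟨ cong (recip z≢0 *_) zx≡zy ⟩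
    recip z≢0 * (z * y)  ≡⟨ *-cancel-inverse (recip-inverseˡ z≢0) y ⟩
    y                    ∎

  *-cancelʳ-nonzero : ∀ {x y} z → z ≢ 0# → x * z ≡ y * z → x ≡ y
  *-cancelʳ-nonzero {x} {y} z z≢0 xz≡yz =
    *-cancelˡ-nonzero z z≢0 (trans (*-comm z x) (trans xz≡yz (*-comm y z)))

  *-nonzero : ∀ {x y} → x ≢ 0# → y ≢ 0# → x * y ≢ 0#
  *-nonzero {x} {y} x≢0 y≢0 xy≡0 = y≢0 (*-cancelˡ-nonzero x x≢0 (trans xy≡0 (sym (zeroʳ x))))

  ^≡^ᴿ : ∀ x n → x ^ n ≡ x ^ᴿ n
  ^≡^ᴿ x zero    = refl
  ^≡^ᴿ x (suc n) = cong (x *_) (^≡^ᴿ x n)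

  ^-homo-* : ∀ x m n → x ^ (m ℕ.+ n) ≡ x ^ m * x ^ n
  ^-homo-* x m n rewrite ^≡^ᴿ x (m ℕ.+ n) | ^≡^ᴿ x m | ^≡^ᴿ x n = ^ᴿ-homo-* x m n

  ^-assocʳ : ∀ x m n → (x ^ m) ^ n ≡ x ^ (m ℕ.* n)
  ^-assocʳ x m n rewrite ^≡^ᴿ (x ^ m) n | ^≡^ᴿ x m | ^≡^ᴿ x (m ℕ.* n) = ^ᴿ-assocʳ x m n

  ^-distrib-* : ∀ x y n → (x * y) ^ n ≡ x ^ n * y ^ n
  ^-distrib-* x y n rewrite ^≡^ᴿ (x * y) n | ^≡^ᴿ x n | ^≡^ᴿ y n = ^ᴿ-distrib-* x y n

  1^n≡1 : ∀ n → 1# ^ n ≡ 1#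
  1^n≡1 zero    = refl
  1^n≡1 (suc n) = trans (*-identityˡ _) (1^n≡1 n)

  0^n≡0 : ∀ n → .{{NonZero n}} → 0# ^ n ≡ 0#
  0^n≡0 (suc n) = zeroˡ (0# ^ n)

  ^-nonzero : ∀ {x} n → x ≢ 0# → x ^ n ≢ 0#
  ^-nonzero zero    x≢0 1≡0 = 0≢1 (sym 1≡0)
  ^-nonzero (suc n) x≢0 = *-nonzero x≢0 (^-nonzero n x≢0)

  ^≡0⇒≡0 : ∀ {x} n → x ^ n ≡ 0# → x ≡ 0#
  ^≡0⇒≡0 {x} n xⁿ≡0 with x ≟ 0#
  ... | yes x≡0 = x≡0
  ... | no x≢0  = ⊥-elim (^-nonzero n x≢0 xⁿ≡0)

  ι≡·1 : ∀ n → ι n ≡ n · 1#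
  ι≡·1 zero    = refl
  ι≡·1 (suc n) = cong (1# +_) (ι≡·1 n)

  ι-homo-+ : ∀ m n → ι (m ℕ.+ n) ≡ ι m + ι n
  ι-homo-+ m n rewrite ι≡·1 (m ℕ.+ n) | ι≡·1 m | ι≡·1 n = ×-homo-+ 1# m n

  ι-homo-* : ∀ m n → ι (m ℕ.* n) ≡ ι m * ι n
  ι-homo-* m n rewrite ι≡·1 (m ℕ.* n) | ι≡·1 m | ι≡·1 n = ×1-homo-* m n

  ι-homo-^ : ∀ m n → ι (m ℕ.^ n) ≡ ι m ^ n
  ι-homo-^ m zero    = +-identityʳ 1#
  ι-homo-^ m (suc n) = trans (ι-homo-* m (m ℕ.^ n)) (cong (ι m *_) (ι-homo-^ m n))

  ι-multiple : ∀ {n} k → ι n ≡ 0# → ι (k ℕ.* n) ≡ 0#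
  ι-multiple {n} k ιn≡0 = trans (ι-homo-* k n) (trans (cong (ι k *_) ιn≡0) (zeroʳ (ι k)))

  ·≡ι* : ∀ n z → n · z ≡ ι n * z
  ·≡ι* n z = begin
    n · z         ≡⟨ cong (n ·_) (sym (*-identityˡ z)) ⟩
    n · (1# * z)  ≡⟨ sym (×-assoc-* n 1# z) ⟩
    n · 1# * z    ≡⟨ cong (_* z) (sym (ι≡·1 n)) ⟩
    ι n * z       ∎

  idx : Carrier → Fin q
  idx = Inverse.from enum

  elt∘idx : ∀ x → elt (idx x) ≡ x
  elt∘idx = Inverse.strictlyInverseˡ enum

  idx∘elt : ∀ j → idx (elt j) ≡ j
  idx∘elt = Inverse.strictlyInverseʳ enum

  elt-injective : Injective _≡_ _≡_ elt
  elt-injective {i} {j} e = trans (sym (idx∘elt i)) (trans (cong idx e) (idx∘elt j))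

  q-nonZero : NonZero q
  q-nonZero = inhabited⇒nonZero (idx 0#)
    where
    inhabited⇒nonZero : ∀ {n} → Fin n → NonZero n
    inhabited⇒nonZero {suc n} _ = _

  ∃? : {P : Carrier → Set} → (∀ x → Dec (P x)) → Dec (Σ Carrier P)
  ∃? {P} P? = map′ (λ (j , Pj) → elt j , Pj) (λ (x , Px) → idx x , subst P (sym (elt∘idx x)) Px)
                   (FinP.any? (P? ∘ elt))

  affine : Carrier → Carrier → Carrier → Carrier
  affine u v x = u * x + v

  -- The inverse is written in affine form too, so that affine invariance
  -- applies to it.
  affine↔ : ∀ {u} → u ≢ 0# → Carrier → Carrier ↔ Carrier
  affine↔ {u} u≢0 v = mk↔ₛ′ (affine u v) (affine u⁻¹ (- (u⁻¹ * v))) to∘from from∘to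
    where
    u⁻¹ = recip u≢0
    to∘from : ∀ y → u * (u⁻¹ * y + - (u⁻¹ * v)) + v ≡ y
    to∘from y = begin
      u * (u⁻¹ * y + - (u⁻¹ * v)) + v        ≡⟨ cong (_+ v) (distribˡ u (u⁻¹ * y) _) ⟩
      u * (u⁻¹ * y) + u * - (u⁻¹ * v) + v    ≡⟨ cong (λ z → u * (u⁻¹ * y) + z + v) (sym (-‿distribʳ-* u _)) ⟩
      u * (u⁻¹ * y) + - (u * (u⁻¹ * v)) + v  ≡⟨ cong₂ (λ a b → a + - b + v) (*-cancel-inverse (recip-inverseʳ u≢0) y)
                                                                        (*-cancel-inverse (recip-inverseʳ u≢0) v) ⟩
      y + - v + v                            ≡⟨ //-rightDividesˡ v y ⟩
      y                                      ∎
    from∘to : ∀ x → u⁻¹ * (u * x + v) + - (u⁻¹ * v) ≡ x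
    from∘to x = begin
      u⁻¹ * (u * x + v) + - (u⁻¹ * v)        ≡⟨ cong (_+ - (u⁻¹ * v)) (distribˡ u⁻¹ (u * x) v) ⟩
      u⁻¹ * (u * x) + u⁻¹ * v + - (u⁻¹ * v)  ≡⟨ //-rightDividesʳ (u⁻¹ * v) (u⁻¹ * (u * x)) ⟩
      u⁻¹ * (u * x)                          ≡⟨ *-cancel-inverse (recip-inverseˡ u≢0) x ⟩
      x                                      ∎

  module FieldSum (M : CommutativeMonoid 0ℓ 0ℓ) where
    open CommutativeMonoid M using (_≈_; reflexive) renaming (Carrier to A; trans to ≈-trans)
    open MonoidSum M using (sum; sum-permute; sum-cong-≗)

    ∑ : (Carrier → A) → A
    ∑ f = sum (f ∘ elt)

    ∑-reindex : (h : Carrier ↔ Carrier) (f : Carrier → A) → ∑ f ≈ ∑ (f ∘ Inverse.to h)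
    ∑-reindex h f = ≈-trans (sum-permute (f ∘ elt) (permutation σ σ⁻¹ σσ⁻¹ σ⁻¹σ))
                            (reflexive (sum-cong-≗ (λ j → cong f (elt∘idx (to (elt j))))))
      where
      open Inverse h using (to; from; strictlyInverseˡ; strictlyInverseʳ)
      σ σ⁻¹ : Fin q → Fin q
      σ j   = idx (to (elt j))
      σ⁻¹ j = idx (from (elt j))
      σσ⁻¹ : ∀ j → σ (σ⁻¹ j) ≡ j
      σσ⁻¹ j rewrite elt∘idx (from (elt j)) | strictlyInverseˡ (elt j) = idx∘elt j
      σ⁻¹σ : ∀ j → σ⁻¹ (σ j) ≡ j
      σ⁻¹σ j rewrite elt∘idx (to (elt j)) | strictlyInverseʳ (elt j) = idx∘elt j

  open FieldSum +-commutativeMonoid using (∑; ∑-reindex)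
  open FieldSum *-commutativeMonoid using () renaming (∑ to ∏; ∑-reindex to ∏-reindex)

  -- Translating every element by 1 does not change their sum.
  ι[q]≡0 : ι q ≡ 0#
  ι[q]≡0 = +-identityʳ-unique (∑ id) (ι q) (begin
    ∑ id + ι q               ≡⟨ cong (∑ id +_) (trans (ι≡·1 q) (sym (+-Sum.sum-replicate q))) ⟩
    ∑ id + ∑ (λ _ → 1#)      ≡⟨ sym (+-Sum.∑-distrib-+ elt (λ _ → 1#)) ⟩
    ∑ (λ x → x + 1#)         ≡⟨ +-Sum.sum-cong-≗ (λ j → cong (_+ 1#) (sym (*-identityˡ (elt j)))) ⟩
    ∑ (λ x → 1# * x + 1#)    ≡⟨ sym (∑-reindex (affine↔ 1≢0 1#) id) ⟩
    ∑ id                     ∎)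
    where
    1≢0 : 1# ≢ 0#
    1≢0 1≡0 = 0≢1 (sym 1≡0)

  ∏-nonzero : ∀ {n} (f : Fin n → Carrier) → (∀ j → f j ≢ 0#) → *-Sum.sum f ≢ 0#
  ∏-nonzero {zero}  f f≢0 1≡0 = 0≢1 (sym 1≡0)
  ∏-nonzero {suc n} f f≢0 = *-nonzero (f≢0 zero) (∏-nonzero (f ∘ suc) (f≢0 ∘ suc))

  ∏-single : ∀ {n} (f : Fin n → Carrier) i → (∀ j → j ≢ i → f j ≡ 1#) → *-Sum.sum f ≡ f i
  ∏-single {suc n} f i f≡1 = begin
    *-Sum.sum f                      ≡⟨ *-Sum.sum-remove f ⟩
    f i * *-Sum.sum (f ∘ punchIn i)  ≡⟨ cong (f i *_) (*-Sum.sum-cong-≗ (λ j → f≡1 _ (FinP.punchInᵢ≢i i j))) ⟩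
    f i * *-Sum.sum {n} (λ _ → 1#)   ≡⟨ cong (f i *_) (*-Sum.sum-replicate-zero n) ⟩
    f i * 1#                         ≡⟨ *-identityʳ (f i) ⟩
    f i                              ∎

  ∏-const : ∀ n x → *-Sum.sum {n} (λ _ → x) ≡ x ^ n
  ∏-const n x = trans (*-Sum.sum-replicate n) (sym (^≡^ᴿ x n))

  nonzeroPart : Carrier → Carrier
  nonzeroPart c with c ≟ 0#
  ... | yes _ = 1#
  ... | no _  = c

  nonzeroPart≢0 : ∀ c → nonzeroPart c ≢ 0#
  nonzeroPart≢0 c with c ≟ 0#
  ... | yes _  = λ 1≡0 → 0≢1 (sym 1≡0)
  ... | no c≢0 = c≢0

  atZero : Carrier → Carrier → Carrier
  atZero x c with c ≟ 0#
  ... | yes _ = x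
  ... | no _  = 1#

  ∏-atZero : ∀ x → ∏ (atZero x) ≡ x
  ∏-atZero x = trans (∏-single (atZero x ∘ elt) (idx 0#) elsewhere) (at0 (elt (idx 0#)) (elt∘idx 0#))
    where
    at0 : ∀ c → c ≡ 0# → atZero x c ≡ x
    at0 c c≡0 with c ≟ 0#
    ... | yes _  = refl
    ... | no c≢0 = ⊥-elim (c≢0 c≡0)
    elsewhere : ∀ j → j ≢ idx 0# → atZero x (elt j) ≡ 1#
    elsewhere j j≢0 with elt j ≟ 0#
    ... | yes j≡0 = ⊥-elim (j≢0 (trans (sym (idx∘elt j)) (cong idx j≡0)))
    ... | no _    = refl

  nonzeroPart-scale : ∀ {x} → x ≢ 0# → ∀ c → nonzeroPart (x * c + 0#) * atZero x c ≡ nonzeroPart c * x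
  nonzeroPart-scale {x} x≢0 c with c ≟ 0# | (x * c + 0#) ≟ 0#
  ... | yes refl | yes _    = refl
  ... | yes refl | no xc≢0  = ⊥-elim (xc≢0 (trans (+-identityʳ (x * 0#)) (zeroʳ x)))
  ... | no c≢0   | yes xc≡0 = ⊥-elim (*-nonzero x≢0 c≢0 (trans (sym (+-identityʳ (x * c))) xc≡0))
  ... | no _     | no _     = trans (*-identityʳ _) (trans (+-identityʳ (x * c)) (*-comm x c))

  -- Multiplication by x ≠ 0 permutes the field, so the product of the
  -- nonzero parts N is unchanged; comparing factorwise gives N x ^ q = N x.
  x^q≡x : ∀ x → x ^ q ≡ x
  x^q≡x x with x ≟ 0#
  ... | yes refl = 0^n≡0 q {{q-nonZero}}
  ... | no x≢0   = *-cancelˡ-nonzero N (∏-nonzero (nonzeroPart ∘ elt) (nonzeroPart≢0 ∘ elt)) (begin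
    N * x ^ q                                      ≡⟨ cong (N *_) (sym (∏-const q x)) ⟩
    N * ∏ (λ _ → x)                                ≡⟨ sym (*-Sum.∑-distrib-+ (nonzeroPart ∘ elt) (λ _ → x)) ⟩
    ∏ (λ c → nonzeroPart c * x)                    ≡⟨ *-Sum.sum-cong-≗ (sym ∘ nonzeroPart-scale x≢0 ∘ elt) ⟩
    ∏ (λ c → nonzeroPart (ax c) * atZero x c)      ≡⟨ *-Sum.∑-distrib-+ (nonzeroPart ∘ ax ∘ elt) (atZero x ∘ elt) ⟩
    ∏ (nonzeroPart ∘ ax) * ∏ (atZero x)            ≡⟨ cong₂ _*_ (sym (∏-reindex (affine↔ x≢0 0#) nonzeroPart))
                                                                (∏-atZero x) ⟩
    N * x                                          ∎)
    where
    N = ∏ nonzeroPart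
    ax = affine x 0#

  -- A monic polynomial of degree n is represented by its n lower
  -- coefficients, constant term first.
  monic : ∀ {n} → Vec Carrier n → Carrier → Carrier
  monic []       t = 1#
  monic (a ∷ as) t = a + t * monic as t

  -- Quotient and remainder of the division by X − r.
  divide : ∀ {n} → Carrier → Vec Carrier (suc n) → Vec Carrier n × Carrier
  divide r (a ∷ [])     = [] , a + r * 1#
  divide r (a ∷ b ∷ bs) = proj₂ d ∷ proj₁ d , a + r * proj₂ d
    where d = divide r (b ∷ bs)

  -- f = (X − r) Q + s, rearranged so that no subtraction occurs.
  divide-correct : ∀ {n} r (f : Vec Carrier (suc n)) t → let (Q , s) = divide r f in
                   monic f t + r * monic Q t ≡ t * monic Q t + s
  divide-correct r (a ∷ []) t =
    solve 4 (λ a t r o → ((a :+ t :* o) :+ r :* o) := (t :* o :+ (a :+ r :* o))) refl a t r 1#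
  divide-correct r (a ∷ b ∷ bs) t = begin
    a + t * g + r * (s + t * Q)    ≡⟨ solve 6 (λ a t r g s Q → (a :+ t :* g :+ r :* (s :+ t :* Q)) :=
                                                              ((a :+ r :* s) :+ t :* (g :+ r :* Q))) refl a t r g s Q ⟩
    a + r * s + t * (g + r * Q)    ≡⟨ cong (λ z → a + r * s + t * z) (divide-correct r (b ∷ bs) t) ⟩
    a + r * s + t * (t * Q + s)    ≡⟨ solve 5 (λ a t r s Q → ((a :+ r :* s) :+ t :* (t :* Q :+ s)) :=
                                                            (t :* (s :+ t :* Q) :+ (a :+ r :* s))) refl a t r s Q ⟩
    t * (s + t * Q) + (a + r * s)  ∎
    where
    g = monic (b ∷ bs) t
    Q = monic (proj₁ (divide r (b ∷ bs))) t
    s = proj₂ (divide r (b ∷ bs))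

  monic-roots : ∀ {n} (f : Vec Carrier n) (ρ : Fin (suc n) → Carrier) →
                Injective _≡_ _≡_ ρ → ¬ (∀ j → monic f (ρ j) ≡ 0#)
  monic-roots []      ρ _ roots = 0≢1 (sym (roots zero))
  monic-roots (a ∷ f) ρ ρ-injective roots =
    monic-roots Q (ρ ∘ suc) (FinP.suc-injective ∘ ρ-injective) Q-roots
    where
    r = ρ zero
    Q = proj₁ (divide r (a ∷ f))
    s = proj₂ (divide r (a ∷ f))
    s≡0 : s ≡ 0#
    s≡0 = sym (+-cancelˡ (r * monic Q r) 0# s (begin
      r * monic Q r + 0#               ≡⟨ trans (+-identityʳ _) (sym (+-identityˡ _)) ⟩
      0# + r * monic Q r               ≡⟨ cong (_+ r * monic Q r) (sym (roots zero)) ⟩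
      monic (a ∷ f) r + r * monic Q r  ≡⟨ divide-correct r (a ∷ f) r ⟩
      r * monic Q r + s                ∎))
    Q-root : ∀ t → t ≢ r → monic (a ∷ f) t ≡ 0# → monic Q t ≡ 0#
    Q-root t t≢r ft≡0 with monic Q t ≟ 0#
    ... | yes Qt≡0 = Qt≡0
    ... | no Qt≢0  = ⊥-elim (t≢r (*-cancelʳ-nonzero (monic Q t) Qt≢0 (begin
      t * monic Q t                    ≡⟨ sym (+-identityʳ _) ⟩
      t * monic Q t + 0#               ≡⟨ cong (t * monic Q t +_) (sym s≡0) ⟩
      t * monic Q t + s                ≡⟨ sym (divide-correct r (a ∷ f) t) ⟩
      monic (a ∷ f) t + r * monic Q t  ≡⟨ cong (_+ r * monic Q t) ft≡0 ⟩
      0# + r * monic Q t               ≡⟨ +-identityˡ _ ⟩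
      r * monic Q t                    ∎)))
    Q-roots : ∀ j → monic Q (ρ (suc j)) ≡ 0#
    Q-roots j = Q-root (ρ (suc j)) (λ e → FinP.0≢1+n (sym (ρ-injective e))) (roots (suc j))

  -- Otherwise t and the ρ j would be n + 1 roots of the monic polynomial
  -- X ^ n − X, whose lower coefficients are 0, −1, 0, …, 0.
  ^-fixedPoints : ∀ n → 1 < n → (ρ : Fin n → Carrier) → Injective _≡_ _≡_ ρ →
                  (∀ j → ρ j ^ n ≡ ρ j) → ∀ t → t ^ n ≡ t → ∃ λ j → t ≡ ρ j
  ^-fixedPoints (suc (suc k)) (s≤s (s≤s z≤n)) ρ ρ-injective ρ-fixed t t-fixed
    with FinP.any? (λ j → t ≟ ρ j)
  ... | yes t∈ρ = t∈ρ
  ... | no t∉ρ  = ⊥-elim (monic-roots X^n-X (t ∷ᶠ ρ) injective roots)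
    where
    X^n-X : Vec Carrier (suc (suc k))
    X^n-X = 0# ∷ - 1# ∷ replicate k 0#
    Xᵏ : ∀ k x → monic (replicate k 0#) x ≡ x ^ k
    Xᵏ zero    x = refl
    Xᵏ (suc k) x = trans (+-identityˡ _) (cong (x *_) (Xᵏ k x))
    fixed⇒root : ∀ x → x ^ suc (suc k) ≡ x → monic X^n-X x ≡ 0#
    fixed⇒root x x-fixed = begin
      0# + x * (- 1# + x * monic (replicate k 0#) x)  ≡⟨ +-identityˡ _ ⟩
      x * (- 1# + x * monic (replicate k 0#) x)       ≡⟨ distribˡ x (- 1#) _ ⟩
      x * - 1# + x * (x * monic (replicate k 0#) x)   ≡⟨ cong₂ _+_ x*-1≡-x (cong (λ z → x * (x * z)) (Xᵏ k x)) ⟩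
      - x + x ^ suc (suc k)                           ≡⟨ cong (- x +_) x-fixed ⟩
      - x + x                                         ≡⟨ -‿inverseˡ x ⟩
      0#                                              ∎
      where
      x*-1≡-x : x * - 1# ≡ - x
      x*-1≡-x = trans (sym (-‿distribʳ-* x 1#)) (cong -_ (*-identityʳ x))
    injective : Injective _≡_ _≡_ (t ∷ᶠ ρ)
    injective {zero}  {zero}  _ = refl
    injective {zero}  {suc j} e = ⊥-elim (t∉ρ (j , e))
    injective {suc i} {zero}  e = ⊥-elim (t∉ρ (i , sym e))
    injective {suc i} {suc j} e = cong suc (ρ-injective e)
    roots : ∀ j → monic X^n-X ((t ∷ᶠ ρ) j) ≡ 0#
    roots zero    = fixed⇒root t t-fixed
    roots (suc j) = fixed⇒root (ρ j) (ρ-fixed j)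

  freshman's-dream : ∀ {n} → 0 < n → (∀ k → 0 < k → k < n → ι (n C k) ≡ 0#) →
                     ∀ x y → (x + y) ^ n ≡ x ^ n + y ^ n
  freshman's-dream {suc n} _ middle≡0 x y = begin
    (x + y) ^ N                                      ≡⟨ ^≡^ᴿ (x + y) N ⟩
    (x + y) ^ᴿ N                                     ≡⟨ Binomial.theorem N x y ⟩
    t zero + +-Sum.sum (tail t)                      ≡⟨ cong (t zero +_) (+-Sum.sum-init-last (tail t)) ⟩
    t zero + (+-Sum.sum middle + t (suc (fromℕ n)))  ≡⟨ cong₂ (λ a b → t zero + (a + b)) middle-sum≡0 last≡x^N ⟩
    t zero + (0# + x ^ N)                            ≡⟨ cong₂ _+_ first≡y^N (+-identityˡ (x ^ N)) ⟩
    y ^ N + x ^ N                                    ≡⟨ +-comm (y ^ N) (x ^ N) ⟩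
    x ^ N + y ^ N                                    ∎
    where
    N = suc n
    t : Fin (suc N) → Carrier
    t = Binomial.binomialTerm x y N
    term : ∀ i k → toℕ i ≡ k → t i ≡ ι (N C k) * (x ^ k * y ^ (N ∸ k))
    term i k refl = trans (·≡ι* (N C toℕ i) _)
      (cong (ι (N C toℕ i) *_) (sym (cong₂ _*_ (^≡^ᴿ x (toℕ i)) (^≡^ᴿ y (N ∸ toℕ i)))))
    first≡y^N : t zero ≡ y ^ N
    first≡y^N = begin
      t zero                 ≡⟨ term zero 0 refl ⟩
      ι 1 * (1# * y ^ N)     ≡⟨ cong (_* (1# * y ^ N)) (+-identityʳ 1#) ⟩
      1# * (1# * y ^ N)      ≡⟨ trans (*-identityˡ _) (*-identityˡ (y ^ N)) ⟩
      y ^ N                  ∎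
    last≡x^N : t (suc (fromℕ n)) ≡ x ^ N
    last≡x^N = begin
      t (suc (fromℕ n))                 ≡⟨ term (suc (fromℕ n)) N (cong suc (FinP.toℕ-fromℕ n)) ⟩
      ι (N C N) * (x ^ N * y ^ (N ∸ N)) ≡⟨ cong₂ (λ c e → ι c * (x ^ N * y ^ e)) (nCn≡1 N) (ℕP.n∸n≡0 N) ⟩
      ι 1 * (x ^ N * 1#)                ≡⟨ cong (_* (x ^ N * 1#)) (+-identityʳ 1#) ⟩
      1# * (x ^ N * 1#)                 ≡⟨ trans (*-identityˡ _) (*-identityʳ (x ^ N)) ⟩
      x ^ N                             ∎
    middle : Fin n → Carrier
    middle j = t (suc (inject₁ j))
    middle-sum≡0 : +-Sum.sum middle ≡ 0#
    middle-sum≡0 = trans (+-Sum.sum-cong-≗ middle-term≡0) (+-Sum.sum-replicate-zero n)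
      where
      middle-term≡0 : ∀ j → middle j ≡ 0#
      middle-term≡0 j = begin
        middle j                             ≡⟨ term (suc (inject₁ j)) k refl ⟩
        ι (N C k) * (x ^ k * y ^ (N ∸ k))    ≡⟨ cong (_* (x ^ k * y ^ (N ∸ k))) (middle≡0 k (s≤s z≤n) k<N) ⟩
        0# * (x ^ k * y ^ (N ∸ k))           ≡⟨ zeroˡ _ ⟩
        0#                                   ∎
        where
        k = suc (toℕ (inject₁ j))
        k<N : k < N
        k<N = s≤s (subst (_< n) (sym (FinP.toℕ-inject₁ j)) (FinP.toℕ<n j))

  Σ<-cong : ∀ n {f g : ℕ → Carrier} → (∀ j → f j ≡ g j) → Σ< n f ≡ Σ< n g
  Σ<-cong zero    f≗g = refl
  Σ<-cong (suc n) f≗g = cong₂ _+_ (Σ<-cong n f≗g) (f≗g n)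

  Σ<-distrib-+ : ∀ n (f g : ℕ → Carrier) → Σ< n (λ j → f j + g j) ≡ Σ< n f + Σ< n g
  Σ<-distrib-+ zero    f g = sym (+-identityʳ 0#)
  Σ<-distrib-+ (suc n) f g = trans (cong (_+ (f n + g n)) (Σ<-distrib-+ n f g))
    (solve 4 (λ a b c d → ((a :+ b) :+ (c :+ d)) := ((a :+ c) :+ (b :+ d))) refl (Σ< n f) (Σ< n g) (f n) (g n))

  Σ<-homo : ∀ (φ : Carrier → Carrier) → φ 0# ≡ 0# → (∀ x y → φ (x + y) ≡ φ x + φ y) →
            ∀ n f → φ (Σ< n f) ≡ Σ< n (φ ∘ f)
  Σ<-homo φ φ0≡0 φ-homo zero    f = φ0≡0
  Σ<-homo φ φ0≡0 φ-homo (suc n) f = trans (φ-homo (Σ< n f) (f n)) (cong (_+ φ (f n)) (Σ<-homo φ φ0≡0 φ-homo n f))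

  Σ<-shift : ∀ n (f : ℕ → Carrier) → Σ< (suc n) f ≡ f 0 + Σ< n (f ∘ suc)
  Σ<-shift zero    f = trans (+-identityˡ (f 0)) (sym (+-identityʳ (f 0)))
  Σ<-shift (suc n) f = trans (cong (_+ f (suc n)) (Σ<-shift n f)) (+-assoc (f 0) _ _)

allSubsets : ∀ n → List (Subset n)
allSubsets zero    = [] ∷ᴸ []ᴸ
allSubsets (suc n) = cartesianProductWith _∷_ (true ∷ᴸ false ∷ᴸ []ᴸ) (allSubsets n)

allSubsets-complete : ∀ {n} (S : Subset n) → S List.∈ allSubsets n
allSubsets-complete []        = here refl
allSubsets-complete (true ∷ S)  =
  ∈-cartesianProductWith⁺ _∷_ {xs = true ∷ᴸ false ∷ᴸ []ᴸ} (here refl) (allSubsets-complete S)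
allSubsets-complete (false ∷ S) =
  ∈-cartesianProductWith⁺ _∷_ {xs = true ∷ᴸ false ∷ᴸ []ᴸ} (there (here refl)) (allSubsets-complete S)

allSubsets-unique : ∀ n → Unique (allSubsets n)
allSubsets-unique zero    = []ᴬ ∷ᴾ []ᴾ
allSubsets-unique (suc n) = cartesianProductWith⁺ _∷_ (λ { refl → refl , refl })
  (((λ ()) ∷ᴬ []ᴬ) ∷ᴾ ([]ᴬ ∷ᴾ []ᴾ)) (allSubsets-unique n)

module _ {A : Set} {P : A → Set} (P? : Decidable P) where

  HasCount-filter : (xs : List A) → Unique xs → (∀ a → a List.∈ xs) → HasCount P (length (filter P? xs))
  HasCount-filter xs xs-unique xs-complete =
    filter P? xs , filter⁺ P? xs-unique ,
    (λ a → (λ a∈ → proj₂ (∈-filter⁻ P? {xs = xs} a∈)) , ∈-filter⁺ P? (xs-complete a)) , refl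

module _ {A B : Set} {P : A → Set} {Q : B → Set} (φ : A ↔ B) where
  open Inverse φ using (to; from; strictlyInverseˡ; strictlyInverseʳ)

  HasCount-↔ : (∀ a → P a → Q (to a)) → (∀ b → Q b → P (from b)) → ∀ {n} → HasCount P n → HasCount Q n
  HasCount-↔ P⇒Q Q⇒P (xs , xs-unique , xs-exact , refl) =
    map to xs , map⁺ to-injective xs-unique , (λ b → sound b , complete b) , length-map to xs
    where
    to-injective : ∀ {a a′} → to a ≡ to a′ → a ≡ a′
    to-injective {a} {a′} e = trans (sym (strictlyInverseʳ a)) (trans (cong from e) (strictlyInverseʳ a′))
    sound : ∀ b → b List.∈ map to xs → Q b
    sound b b∈ with ∈-map⁻ to b∈
    ... | a , a∈ , refl = P⇒Q a (proj₁ (xs-exact a) a∈)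
    complete : ∀ b → Q b → b List.∈ map to xs
    complete b Qb =
      subst (List._∈ map to xs) (strictlyInverseˡ b) (∈-map⁺ to (proj₂ (xs-exact (from b)) (Q⇒P b Qb)))

module AffineDesign (p m : ℕ) (F : FiniteField (p ℕ.^ m)) where
  open FiniteField F
  open FieldProperties F
  open Setting p m F
  open ≡-Reasoning

  preimage : (Carrier → Carrier) → Subset q → Subset q
  preimage h S = tabulate (λ j → lookup S (idx (h (elt j))))

  ∈-preimage : ∀ h S {j k} → h (elt j) ≡ elt k → k ∈ S → j ∈ preimage h S
  ∈-preimage h S {j} {k} hj≡k k∈S = lookup⇒[]= j (preimage h S) (begin
    lookup (preimage h S) j     ≡⟨ lookup∘tabulate _ j ⟩
    lookup S (idx (h (elt j)))  ≡⟨ cong (lookup S ∘ idx) hj≡k ⟩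
    lookup S (idx (elt k))      ≡⟨ cong (lookup S) (idx∘elt k) ⟩
    lookup S k                  ≡⟨ []=⇒lookup k∈S ⟩
    true                        ∎)

  preimage-∘ : ∀ g h S → preimage g (preimage h S) ≡ preimage (h ∘ g) S
  preimage-∘ g h S = tabulate-cong (λ j → trans (lookup∘tabulate _ (idx (g (elt j))))
                       (cong (λ x → lookup S (idx (h x))) (elt∘idx (g (elt j)))))

  preimage-id : ∀ {h} S → (∀ x → h x ≡ x) → preimage h S ≡ S
  preimage-id {h} S h≗id =
    trans (tabulate-cong (λ j → cong (lookup S) (trans (cong idx (h≗id (elt j))) (idx∘elt j)))) (tabulate∘lookup S)

  preimage↔ : Carrier ↔ Carrier → Subset q ↔ Subset q
  preimage↔ h = mk↔ₛ′ (preimage to) (preimage from)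
    (λ S → trans (preimage-∘ to from S) (preimage-id S strictlyInverseʳ))
    (λ S → trans (preimage-∘ from to S) (preimage-id S strictlyInverseˡ))
    where open Inverse h using (to; from; strictlyInverseˡ; strictlyInverseʳ)

  module ℕ-Sum = MonoidSum ℕP.+-0-commutativeMonoid
  open FieldSum ℕP.+-0-commutativeMonoid using () renaming (∑ to ∑ℕ; ∑-reindex to ∑ℕ-reindex)

  χ : Bool → ℕ
  χ b = if b then 1 else 0

  ∣_∣≡∑χ : ∀ {n} (S : Subset n) → ∣ S ∣ ≡ ℕ-Sum.sum (χ ∘ lookup S)
  ∣ []        ∣≡∑χ = refl
  ∣ true ∷ S  ∣≡∑χ = cong suc ∣ S ∣≡∑χ
  ∣ false ∷ S ∣≡∑χ = ∣ S ∣≡∑χ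

  ∣preimage∣ : ∀ (h : Carrier ↔ Carrier) S → ∣ preimage (Inverse.to h) S ∣ ≡ ∣ S ∣
  ∣preimage∣ h S = begin
    ∣ preimage to S ∣                          ≡⟨ ∣ preimage to S ∣≡∑χ ⟩
    ℕ-Sum.sum (χ ∘ lookup (preimage to S))    ≡⟨ ℕ-Sum.sum-cong-≗ (cong χ ∘ lookup∘tabulate (lookup S ∘ idx ∘ to ∘ elt)) ⟩
    ∑ℕ (χS ∘ to)                              ≡⟨ sym (∑ℕ-reindex h χS) ⟩
    ∑ℕ χS                                     ≡⟨ ℕ-Sum.sum-cong-≗ (cong (χ ∘ lookup S) ∘ idx∘elt) ⟩
    ℕ-Sum.sum (χ ∘ lookup S)                  ≡⟨ sym ∣ S ∣≡∑χ ⟩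
    ∣ S ∣                                     ∎
    where
    open Inverse h using (to)
    χS : Carrier → ℕ
    χS x = χ (lookup S (idx x))

  supp-∘ : ∀ w h → supp (w ∘ h) ≡ preimage h (supp w)
  supp-∘ w h = tabulate-cong (λ j → sym (trans (lookup∘tabulate _ (idx (h (elt j))))
                 (cong (λ x → not ⌊ w x ≟ 0# ⌋) (elt∘idx (h (elt j))))))

  supp-cong : ∀ {w w′} → (∀ x → w x ≡ w′ x) → supp w ≡ supp w′
  supp-cong w≗w′ = tabulate-cong (λ j → cong (λ z → not ⌊ z ≟ 0# ⌋) (w≗w′ (elt j)))

  AffineInvariant : (Word → Set) → Set
  AffineInvariant D = ∀ {u} v → u ≢ 0# → ∀ w → D w → D (w ∘ affine u v)

  module _ {D : Word → Set} (D-invariant : AffineInvariant D) (i : ℕ) where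

    IsBlock-preimage : ∀ {u} v (u≢0 : u ≢ 0#) S → IsBlock D i S → IsBlock D i (preimage (affine u v) S)
    IsBlock-preimage {u} v u≢0 S (w , Dw , wt≡i , refl) =
      w ∘ affine u v , D-invariant v u≢0 w Dw ,
      trans (cong ∣_∣ (supp-∘ w (affine u v))) (trans (∣preimage∣ (affine↔ u≢0 v) (supp w)) wt≡i) ,
      supp-∘ w (affine u v)

    Through : Fin q → Fin q → Subset q → Set
    Through x y S = IsBlock D i S × x ∈ S × y ∈ S

    -- The affine map α : t ↦ (Y − X) t + X sends 0, 1 to X, Y, so taking
    -- preimages under α and α⁻¹ matches the blocks through {X, Y} with those
    -- through {0, 1}.
    HasCount-Through : ∀ {x y} → x ≢ y → ∀ {n} →
                       HasCount (Through (idx 0#) (idx 1#)) n → HasCount (Through x y) n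
    HasCount-Through {x} {y} x≢y = HasCount-↔ (↔-sym (preimage↔ α)) to-xy to-01
      where
      X = elt x
      Y = elt y
      d≢0 : Y + - X ≢ 0#
      d≢0 d≡0 = x≢y (elt-injective (sym (x∙y⁻¹≈ε⇒x≈y Y X d≡0)))
      α : Carrier ↔ Carrier
      α = affine↔ d≢0 X
      open Inverse α using (to; from; strictlyInverseʳ)
      α0≡X : to 0# ≡ X
      α0≡X = trans (cong (_+ X) (zeroʳ (Y + - X))) (+-identityˡ X)
      α1≡Y : to 1# ≡ Y
      α1≡Y = trans (cong (_+ X) (*-identityʳ (Y + - X))) (//-rightDividesˡ X Y)
      to-xy : ∀ S → Through (idx 0#) (idx 1#) S → Through x y (preimage from S)
      to-xy S (S-block , 0∈S , 1∈S) =
        IsBlock-preimage _ (recip-nonzero d≢0) S S-block ,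
        ∈-preimage from S (trans (cong from (sym α0≡X)) (trans (strictlyInverseʳ 0#) (sym (elt∘idx 0#)))) 0∈S ,
        ∈-preimage from S (trans (cong from (sym α1≡Y)) (trans (strictlyInverseʳ 1#) (sym (elt∘idx 1#)))) 1∈S
      to-01 : ∀ S → Through x y S → Through (idx 0#) (idx 1#) (preimage to S)
      to-01 S (S-block , x∈S , y∈S) =
        IsBlock-preimage X d≢0 S S-block ,
        ∈-preimage to S (trans (cong to (elt∘idx 0#)) α0≡X) x∈S ,
        ∈-preimage to S (trans (cong to (elt∘idx 1#)) α1≡Y) y∈S

    affineInvariant⇒2-design : (∀ S → Dec (IsBlock D i S)) → Σ ℕ λ λ′ → Is2Design q i λ′ (IsBlock D i)
    affineInvariant⇒2-design IsBlock? =
      length (filter Through01? (allSubsets q)) , block-size ,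
      λ x y x≢y → HasCount-Through x≢y
                    (HasCount-filter Through01? (allSubsets q) (allSubsets-unique q) allSubsets-complete)
      where
      Through01? : ∀ S → Dec (Through (idx 0#) (idx 1#) S)
      Through01? S = IsBlock? S ×-dec (idx 0# ∈? S ×-dec idx 1# ∈? S)
      block-size : ∀ S → IsBlock D i S → ∣ S ∣ ≡ i
      block-size S (w , _ , wt≡i , refl) = wt≡i

prime∤! : ∀ {p k} → Prime p → k < p → ¬ p ∣ k !
prime∤! {p} {zero}  p-prime _   p∣1 = ¬prime[1] (subst Prime (∣1⇒≡1 p∣1) p-prime)
prime∤! {p} {suc k} p-prime k<p p∣k! with euclidsLemma (suc k) (k !) p-prime p∣k!
... | inj₁ p∣1+k  = ℕP.<⇒≱ k<p (∣⇒≤ p∣1+k)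
... | inj₂ p∣k!′  = prime∤! p-prime (ℕP.<-trans (ℕP.n<1+n k) k<p) p∣k!′

prime∣choose : ∀ {p k} → Prime p → 0 < k → k < p → p ∣ p C k
prime∣choose {p@(suc p′)} {k} p-prime 0<k k<p with euclidsLemma (p C k) (k ! ℕ.* (p ∸ k) !) p-prime p∣p!
  where
  instance _ : NonZero (k ! ℕ.* (p ∸ k) !)
           _ = ℕP.m*n≢0 (k !) ((p ∸ k) !) {{k ℕP.!≢0}} {{(p ∸ k) ℕP.!≢0}}
  p∣p! : p ∣ (p C k) ℕ.* (k ! ℕ.* (p ∸ k) !)
  p∣p! = subst (p ∣_)
    (sym (trans (cong (ℕ._* (k ! ℕ.* (p ∸ k) !)) (nCk≡n!/k![n-k]! (ℕP.<⇒≤ k<p)))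
                (m/n*n≡m (k![n∸k]!∣n! (ℕP.<⇒≤ k<p)))))
    (m∣m*n (p′ !))
... | inj₁ p∣C = p∣C
... | inj₂ p∣k![p∸k]! with euclidsLemma (k !) ((p ∸ k) !) p-prime p∣k![p∸k]!
...   | inj₁ p∣k!     = ⊥-elim (prime∤! p-prime k<p p∣k!)
...   | inj₂ p∣[p∸k]! = ⊥-elim (prime∤! p-prime (ℕP.∸-monoʳ-< {p} {k} {0} 0<k (ℕP.<⇒≤ k<p)) p∣[p∸k]!)

module Characteristic (p m : ℕ) (F : FiniteField (p ℕ.^ m)) (p-prime : Prime p) where
  open FiniteField F
  open FieldProperties F
  open Setting p m F using (q; Tr; InFp)
  open ≡-Reasoning

  instance
    p-nonZero : NonZero p
    p-nonZero = prime⇒nonZero p-prime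

  ι[p]≡0 : ι p ≡ 0#
  ι[p]≡0 = ^≡0⇒≡0 m (trans (sym (ι-homo-^ p m)) ι[q]≡0)

  1+multiple≢multiple : ∀ {u v} a b → ι u ≡ 0# → ι v ≡ 0# → suc (a ℕ.* u) ≢ b ℕ.* v
  1+multiple≢multiple {u} {v} a b ιu≡0 ιv≡0 e = 0≢1 (begin
    0#                ≡⟨ sym (ι-multiple b ιv≡0) ⟩
    ι (b ℕ.* v)       ≡⟨ cong ι (sym e) ⟩
    1# + ι (a ℕ.* u)  ≡⟨ cong (1# +_) (ι-multiple a ιu≡0) ⟩
    1# + 0#           ≡⟨ +-identityʳ 1# ⟩
    1#                ∎)

  ι-nonzero : ∀ {d} → 0 < d → d < p → ι d ≢ 0#
  ι-nonzero {d} 0<d d<p ιd≡0 with coprime-Bézout (prime⇒coprime p-prime {{ℕ.>-nonZero 0<d}} d<p)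
  ... | Bézout.+- a b 1+bd≡ap = 1+multiple≢multiple b a ιd≡0 ι[p]≡0 1+bd≡ap
  ... | Bézout.-+ a b 1+ap≡bd = 1+multiple≢multiple a b ι[p]≡0 ιd≡0 1+ap≡bd

  ι-gap : ∀ {a b} → a < b → b < p → ι a ≢ ι b
  ι-gap {a} {b} a<b b<p ιa≡ιb = ι-nonzero (ℕP.m<n⇒0<n∸m a<b) (ℕP.≤-<-trans (ℕP.m∸n≤m b a) b<p)
    (+-identityʳ-unique (ι a) _ (begin
      ι a + ι (b ∸ a)    ≡⟨ sym (ι-homo-+ a (b ∸ a)) ⟩
      ι (a ℕ.+ (b ∸ a))  ≡⟨ cong ι (ℕP.m+[n∸m]≡n (ℕP.<⇒≤ a<b)) ⟩
      ι b                ≡⟨ sym ιa≡ιb ⟩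
      ι a                ∎))

  ι-injective : ∀ {j k} → j < p → k < p → ι j ≡ ι k → j ≡ k
  ι-injective {j} {k} j<p k<p ιj≡ιk with ℕP.<-cmp j k
  ... | tri< j<k _ _ = ⊥-elim (ι-gap j<k k<p ιj≡ιk)
  ... | tri≈ _ j≡k _ = j≡k
  ... | tri> _ _ k<j = ⊥-elim (ι-gap k<j j<p (sym ιj≡ιk))

  frobenius : ∀ x y → (x + y) ^ p ≡ x ^ p + y ^ p
  frobenius = freshman's-dream (ℕ.>-nonZero⁻¹ p) λ k 0<k k<p → ι[p∣] (prime∣choose p-prime 0<k k<p)
    where
    ι[p∣] : ∀ {n} → p ∣ n → ι n ≡ 0#
    ι[p∣] (divides r refl) = ι-multiple r ι[p]≡0

  frobenius^ : ∀ k x y → (x + y) ^ (p ℕ.^ k) ≡ x ^ (p ℕ.^ k) + y ^ (p ℕ.^ k)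
  frobenius^ zero    x y = trans (*-identityʳ (x + y)) (sym (cong₂ _+_ (*-identityʳ x) (*-identityʳ y)))
  frobenius^ (suc k) x y = begin
    (x + y) ^ (p ℕ.* p ℕ.^ k)                  ≡⟨ sym (^-assocʳ (x + y) p (p ℕ.^ k)) ⟩
    ((x + y) ^ p) ^ (p ℕ.^ k)                  ≡⟨ cong (_^ (p ℕ.^ k)) (frobenius x y) ⟩
    (x ^ p + y ^ p) ^ (p ℕ.^ k)                ≡⟨ frobenius^ k (x ^ p) (y ^ p) ⟩
    (x ^ p) ^ (p ℕ.^ k) + (y ^ p) ^ (p ℕ.^ k)  ≡⟨ cong₂ _+_ (^-assocʳ x p (p ℕ.^ k)) (^-assocʳ y p (p ℕ.^ k)) ⟩
    x ^ (p ℕ.* p ℕ.^ k) + y ^ (p ℕ.* p ℕ.^ k)  ∎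

  ι-fixed : ∀ k → ι k ^ p ≡ ι k
  ι-fixed zero    = 0^n≡0 p
  ι-fixed (suc k) = trans (frobenius 1# (ι k)) (cong₂ _+_ (1^n≡1 p) (ι-fixed k))

  InFp⇒fixed : ∀ {x} → InFp x → x ^ p ≡ x
  InFp⇒fixed (k , refl) = ι-fixed (toℕ k)

  fixed⇒InFp : ∀ {x} → x ^ p ≡ x → InFp x
  fixed⇒InFp {x} = ^-fixedPoints p (ℕ.nonTrivial⇒n>1 p {{prime⇒nonTrivial p-prime}}) (ι ∘ toℕ) ι∘toℕ-injective
                     (ι-fixed ∘ toℕ) x
    where
    ι∘toℕ-injective : ∀ {j k} → ι (toℕ j) ≡ ι (toℕ k) → j ≡ k
    ι∘toℕ-injective {j} {k} e = FinP.toℕ-injective (ι-injective (FinP.toℕ<n j) (FinP.toℕ<n k) e)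

  InFp-+ : ∀ {x y} → InFp x → InFp y → InFp (x + y)
  InFp-+ {x} {y} x∈Fp y∈Fp = fixed⇒InFp (trans (frobenius x y) (cong₂ _+_ (InFp⇒fixed x∈Fp) (InFp⇒fixed y∈Fp)))

  InFp? : ∀ x → Dec (InFp x)
  InFp? x = FinP.any? (λ k → x ≟ ι (toℕ k))

  Tr-homo-+ : ∀ x y → Tr (x + y) ≡ Tr x + Tr y
  Tr-homo-+ x y = trans (Σ<-cong m (λ j → frobenius^ j x y)) (Σ<-distrib-+ m _ _)

  -- Tr (x ^ p) is the sum of the conjugates shifted by one, and the last
  -- conjugate x ^ (p ^ m) wraps around to x.
  Tr-^p : ∀ x → Tr (x ^ p) ≡ Tr x
  Tr-^p x = +-cancelˡ (f 0) _ _ (begin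
    f 0 + Tr (x ^ p)      ≡⟨ cong (f 0 +_) (Σ<-cong m (λ j → ^-assocʳ x p (p ℕ.^ j))) ⟩
    f 0 + Σ< m (f ∘ suc)  ≡⟨ sym (Σ<-shift m f) ⟩
    Tr x + f m            ≡⟨ cong (Tr x +_) (trans (x^q≡x x) (sym (*-identityʳ x))) ⟩
    Tr x + f 0            ≡⟨ +-comm (Tr x) (f 0) ⟩
    f 0 + Tr x            ∎)
    where
    f : ℕ → Carrier
    f j = x ^ (p ℕ.^ j)

  Tr-^p^ : ∀ k x → Tr (x ^ (p ℕ.^ k)) ≡ Tr x
  Tr-^p^ zero    x = cong Tr (*-identityʳ x)
  Tr-^p^ (suc k) x = begin
    Tr (x ^ (p ℕ.* p ℕ.^ k))  ≡⟨ cong Tr (sym (^-assocʳ x p (p ℕ.^ k))) ⟩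
    Tr ((x ^ p) ^ (p ℕ.^ k))  ≡⟨ Tr-^p^ k (x ^ p) ⟩
    Tr (x ^ p)                ≡⟨ Tr-^p x ⟩
    Tr x                      ∎

  Tr∈Fp : ∀ x → InFp (Tr x)
  Tr∈Fp x = fixed⇒InFp (begin
    Tr x ^ p                          ≡⟨ Σ<-homo (_^ p) (0^n≡0 p) frobenius m _ ⟩
    Σ< m (λ j → (x ^ (p ℕ.^ j)) ^ p)  ≡⟨ Σ<-cong m conjugate-^p ⟩
    Tr (x ^ p)                        ≡⟨ Tr-^p x ⟩
    Tr x                              ∎)
    where
    conjugate-^p : ∀ j → (x ^ (p ℕ.^ j)) ^ p ≡ (x ^ p) ^ (p ℕ.^ j)
    conjugate-^p j = begin
      (x ^ (p ℕ.^ j)) ^ p  ≡⟨ ^-assocʳ x (p ℕ.^ j) p ⟩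
      x ^ (p ℕ.^ j ℕ.* p)  ≡⟨ cong (x ^_) (ℕP.*-comm (p ℕ.^ j) p) ⟩
      x ^ (p ℕ.* p ℕ.^ j)  ≡⟨ sym (^-assocʳ x p (p ℕ.^ j)) ⟩
      (x ^ p) ^ (p ℕ.^ j)  ∎

  x^q^k≡x : ∀ k x → x ^ (q ℕ.^ k) ≡ x
  x^q^k≡x zero    x = *-identityʳ x
  x^q^k≡x (suc k) x = trans (sym (^-assocʳ x q (q ℕ.^ k))) (trans (cong (_^ (q ℕ.^ k)) (x^q≡x x)) (x^q^k≡x k x))

  -- Raising to the power p ^ ((m − 1) l) undoes x ↦ x ^ (p ^ l), since
  -- l + (m − 1) l = m l and x ^ (q ^ l) = x.
  Tr-adjoint : .{{NonZero m}} → ∀ l y x → Tr (y * x ^ (p ℕ.^ l)) ≡ Tr (y ^ (p ℕ.^ ((m ∸ 1) ℕ.* l)) * x)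
  Tr-adjoint l y x = begin
    Tr (y * x ^ P)                            ≡⟨ sym (Tr-^p^ K (y * x ^ P)) ⟩
    Tr ((y * x ^ P) ^ (p ℕ.^ K))              ≡⟨ cong Tr (^-distrib-* y (x ^ P) (p ℕ.^ K)) ⟩
    Tr (y ^ (p ℕ.^ K) * (x ^ P) ^ (p ℕ.^ K))  ≡⟨ cong (λ z → Tr (y ^ (p ℕ.^ K) * z)) x^P^p^K≡x ⟩
    Tr (y ^ (p ℕ.^ K) * x)                    ∎
    where
    P = p ℕ.^ l
    K = (m ∸ 1) ℕ.* l
    x^P^p^K≡x : (x ^ P) ^ (p ℕ.^ K) ≡ x
    x^P^p^K≡x = begin
      (x ^ P) ^ (p ℕ.^ K)    ≡⟨ ^-assocʳ x P (p ℕ.^ K) ⟩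
      x ^ (P ℕ.* p ℕ.^ K)    ≡⟨ cong (x ^_) (sym (ℕP.^-distribˡ-+-* p l K)) ⟩
      x ^ (p ℕ.^ (l ℕ.+ K))  ≡⟨ cong (λ e → x ^ (p ℕ.^ (e ℕ.* l))) (ℕP.suc-pred m) ⟩
      x ^ (p ℕ.^ (m ℕ.* l))  ≡⟨ cong (x ^_) (sym (ℕP.^-*-assoc p m l)) ⟩
      x ^ (q ℕ.^ l)          ≡⟨ x^q^k≡x l x ⟩
      x                      ∎

module TraceCodes (p m : ℕ) (F : FiniteField (p ℕ.^ m)) (p-prime : Prime p) .{{_ : NonZero m}} (l : ℕ) where
  open FiniteField F
  open FieldProperties F
  open Characteristic p m F p-prime
  open Setting p m F
  open AffineDesign p m F using (AffineInvariant; affineInvariant⇒2-design; supp-cong)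
  open ≡-Reasoning

  P = p ℕ.^ l

  quadratic : Carrier → Carrier → Carrier → Carrier → Carrier
  quadratic a b c x = a * x ^ (P ℕ.+ 1) + b * x ^ 2 + c * x

  quadratic-expand : ∀ a b c x → quadratic a b c x ≡ a * (x ^ P * x) + b * (x * x) + c * x
  quadratic-expand a b c x = cong₂ (λ s t → a * s + b * t + c * x)
    (trans (^-homo-* x P 1) (cong (x ^ P *_) (*-identityʳ x))) (cong (x *_) (*-identityʳ x))

  linear≡quadratic : ∀ a c x → a * x ^ (P ℕ.+ 1) + c * x ≡ quadratic a 0# c x
  linear≡quadratic a c x =
    cong (_+ c * x) (sym (trans (cong (a * x ^ (P ℕ.+ 1) +_) (zeroˡ (x ^ 2))) (+-identityʳ _)))

  -- The coefficient of x after substituting u x + v, including the term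
  -- a u ^ P v x ^ P moved onto x by Tr-adjoint.
  linearCoefficient : Carrier → Carrier → Carrier → Carrier → Carrier → Carrier
  linearCoefficient a b c u v =
    a * v ^ P * u + (b * u * v + b * v * u) + c * u + (a * u ^ P * v) ^ (p ℕ.^ ((m ∸ 1) ℕ.* l))

  Tr-quadratic-affine : ∀ a b c u v x →
    Tr (quadratic a b c (u * x + v)) ≡
    Tr (quadratic (a * u ^ P * u) (b * u * u) (linearCoefficient a b c u v) x) + Tr (quadratic a b c v)
  Tr-quadratic-affine a b c u v x = begin
    Tr (quadratic a b c g)                                  ≡⟨ cong Tr (quadratic-expand a b c g) ⟩
    Tr (a * (g ^ P * g) + b * (g * g) + c * g)              ≡⟨ cong (λ z → Tr (a * (z * g) + b * (g * g) + c * g)) g^P ⟩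
    Tr (a * ((U * X + V) * g) + b * (g * g) + c * g)        ≡⟨ cong Tr expand ⟩
    Tr (main + (D * X + E))                                 ≡⟨ Tr-homo-+ main (D * X + E) ⟩
    Tr main + Tr (D * X + E)                                ≡⟨ cong (Tr main +_) (Tr-homo-+ (D * X) E) ⟩
    Tr main + (Tr (D * X) + Tr E)                           ≡⟨ cong (λ z → Tr main + (z + Tr E)) (Tr-adjoint l D x) ⟩
    Tr main + (Tr (D′ * x) + Tr E)                          ≡⟨ sym (+-assoc (Tr main) _ _) ⟩
    Tr main + Tr (D′ * x) + Tr E                            ≡⟨ cong (_+ Tr E) (sym (Tr-homo-+ main (D′ * x))) ⟩
    Tr (main + D′ * x) + Tr E                               ≡⟨ cong (λ z → Tr z + Tr E) collect ⟩
    Tr (A * (X * x) + B * (x * x) + (L₀ + D′) * x) + Tr E   ≡⟨ sym (cong₂ (λ s t → Tr s + Tr t)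
                                                                 (quadratic-expand A B (L₀ + D′) x) (quadratic-expand a b c v)) ⟩
    Tr (quadratic A B (L₀ + D′) x) + Tr (quadratic a b c v) ∎
    where
    g = u * x + v
    U = u ^ P
    V = v ^ P
    X = x ^ P
    A = a * U * u
    B = b * u * u
    L₀ = a * V * u + (b * u * v + b * v * u) + c * u
    D = a * U * v
    D′ = D ^ (p ℕ.^ ((m ∸ 1) ℕ.* l))
    E = a * (V * v) + b * (v * v) + c * v
    main = A * (X * x) + B * (x * x) + L₀ * x
    g^P : g ^ P ≡ U * X + V
    g^P = trans (frobenius^ l (u * x) v) (cong (_+ V) (^-distrib-* u x P))
    expand : a * ((U * X + V) * g) + b * (g * g) + c * g ≡ main + (D * X + E)
    expand = solve 9 (λ a b c U V X x u v →
      (a :* ((U :* X :+ V) :* (u :* x :+ v)) :+ b :* ((u :* x :+ v) :* (u :* x :+ v)) :+ c :* (u :* x :+ v)) :=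
      ((a :* U :* u :* (X :* x) :+ b :* u :* u :* (x :* x) :+ (a :* V :* u :+ (b :* u :* v :+ b :* v :* u) :+ c :* u) :* x)
        :+ (a :* U :* v :* X :+ (a :* (V :* v) :+ b :* (v :* v) :+ c :* v)))) refl a b c U V X x u v
    collect : main + D′ * x ≡ A * (X * x) + B * (x * x) + (L₀ + D′) * x
    collect = solve 7 (λ A B L D′ Xx xx x →
      ((A :* Xx :+ B :* xx :+ L :* x) :+ D′ :* x) := (A :* Xx :+ B :* xx :+ (L :+ D′) :* x))
      refl A B L₀ D′ (X * x) (x * x) x

  D₁-invariant : AffineInvariant (InD₁ l)
  D₁-invariant {u} v _ w (a , b , c , h , h∈Fp , w≡) =
    A , B , L , E + h , InFp-+ (Tr∈Fp _) h∈Fp , λ x → begin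
      w (u * x + v)                          ≡⟨ w≡ (u * x + v) ⟩
      Tr (quadratic a b c (u * x + v)) + h   ≡⟨ cong (_+ h) (Tr-quadratic-affine a b c u v x) ⟩
      Tr (quadratic A B L x) + E + h         ≡⟨ +-assoc _ E h ⟩
      Tr (quadratic A B L x) + (E + h)       ∎
    where
    A = a * u ^ P * u
    B = b * u * u
    L = linearCoefficient a b c u v
    E = Tr (quadratic a b c v)

  D₂-invariant : AffineInvariant (InD₂ l)
  D₂-invariant {u} v _ w (a , c , h , h∈Fp , w≡) =
    A , L , E + h , InFp-+ (Tr∈Fp _) h∈Fp , λ x → begin
      w (u * x + v)                                           ≡⟨ w≡ (u * x + v) ⟩
      Tr (a * (u * x + v) ^ (P ℕ.+ 1) + c * (u * x + v)) + h  ≡⟨ cong (λ z → Tr z + h) (linear≡quadratic a c (u * x + v)) ⟩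
      Tr (quadratic a 0# c (u * x + v)) + h                   ≡⟨ cong (_+ h) (Tr-quadratic-affine a 0# c u v x) ⟩
      Tr (quadratic A (0# * u * u) L x) + E + h               ≡⟨ cong (λ z → Tr (quadratic A z L x) + E + h) 0uu≡0 ⟩
      Tr (quadratic A 0# L x) + E + h                         ≡⟨ cong (λ z → Tr z + E + h) (sym (linear≡quadratic A L x)) ⟩
      Tr (A * x ^ (P ℕ.+ 1) + L * x) + E + h                  ≡⟨ +-assoc _ E h ⟩
      Tr (A * x ^ (P ℕ.+ 1) + L * x) + (E + h)                ∎
    where
    A = a * u ^ P * u
    L = linearCoefficient a 0# c u v
    E = Tr (quadratic a 0# c v)
    0uu≡0 : 0# * u * u ≡ 0#
    0uu≡0 = trans (cong (_* u) (zeroˡ u)) (zeroˡ u)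

  BlockOf : Word → ℕ → Subset q → Set
  BlockOf w i S = wt w ≡ i × supp w ≡ S

  BlockOf-cong : ∀ {w w′ i S} → (∀ x → w x ≡ w′ x) → BlockOf w i S → BlockOf w′ i S
  BlockOf-cong w≗w′ (wt≡i , refl) = trans (cong ∣_∣ (sym (supp-cong w≗w′))) wt≡i , sym (supp-cong w≗w′)

  BlockOf? : ∀ w i S → Dec (BlockOf w i S)
  BlockOf? w i S = wt w ℕP.≟ i ×-dec ≡-dec Bool._≟_ (supp w) S

  IsBlock₁? : ∀ i S → Dec (IsBlock (InD₁ l) i S)
  IsBlock₁? i S = map′
    (λ (a , b , c , h , h∈Fp , block) → word a b c h , (a , b , c , h , h∈Fp , λ _ → refl) , block)
    (λ (w , (a , b , c , h , h∈Fp , w≗) , block) → a , b , c , h , h∈Fp , BlockOf-cong w≗ block)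
    (∃? λ a → ∃? λ b → ∃? λ c → ∃? λ h → InFp? h ×-dec BlockOf? (word a b c h) i S)
    where
    word : Carrier → Carrier → Carrier → Carrier → Word
    word a b c h x = Tr (quadratic a b c x) + h

  IsBlock₂? : ∀ i S → Dec (IsBlock (InD₂ l) i S)
  IsBlock₂? i S = map′
    (λ (a , c , h , h∈Fp , block) → word a c h , (a , c , h , h∈Fp , λ _ → refl) , block)
    (λ (w , (a , c , h , h∈Fp , w≗) , block) → a , c , h , h∈Fp , BlockOf-cong w≗ block)
    (∃? λ a → ∃? λ c → ∃? λ h → InFp? h ×-dec BlockOf? (word a c h) i S)
    where
    word : Carrier → Carrier → Carrier → Word
    word a c h x = Tr (a * x ^ (P ℕ.+ 1) + c * x) + h

  D₁-2-design : ∀ i → Σ ℕ λ λ′ → Is2Design q i λ′ (IsBlock (InD₁ l) i)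
  D₁-2-design i = affineInvariant⇒2-design D₁-invariant i (IsBlock₁? i)

  D₂-2-design : ∀ i → Σ ℕ λ λ′ → Is2Design q i λ′ (IsBlock (InD₂ l) i)
  D₂-2-design i = affineInvariant⇒2-design D₂-invariant i (IsBlock₂? i)

-- Opened only here: in the modules above it would clash with the field's _^_.
open import Data.Nat using (_^_)

theorem4p2 : (p m l : ℕ) → Prime p → p ≢ 2 → 3 ≤ m → 1 ≤ l → gcd m l ≡ 1 →
    (F : FiniteField (p ^ m)) →
    let open Setting p m F in
    (D : Word → Set) → (D ≡ InD₁ l ⊎ D ≡ InD₂ l) →
    (i : ℕ) → 0 < i → (Σ Word λ w → D w × wt w ≡ i) →
    Σ ℕ λ λ' → Is2Design (p ^ m) i λ' (IsBlock D i)
theorem4p2 p m l p-prime _ 3≤m _ _ F D D≡D₁⊎D₂ i _ _ = design D≡D₁⊎D₂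
  where
  instance
    m-nonZero : NonZero m
    m-nonZero = ℕ.>-nonZero (ℕP.≤-trans (s≤s z≤n) 3≤m)
  open Setting p m F
  open TraceCodes p m F p-prime l
  design : ∀ {D} → D ≡ InD₁ l ⊎ D ≡ InD₂ l → Σ ℕ λ λ′ → Is2Design q i λ′ (IsBlock D i)
  design (inj₁ refl) = D₁-2-design i
  design (inj₂ refl) = D₂-2-design i
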